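{- Let $A$ be a symmetric integer matrix such that $$A\pmod 4=\mathrm{diag}\Big(r\begin{pmatrix}2&1\\1&2\end{pmatrix}, s\begin{pmatrix}0&1\\1&0\end{pmatrix}, t\begin{pmatrix}0&2\\2&0\end{pmatrix}, p(2), m(0)\Big)$$ for non-negative integers $r,s,t,m$ and $p\ge1$. Then for every integer $r'$ with $0\le r'\le r+s$ there is an integer matrix $P$ with $\det(P)=\pm1$ such that $$P^TAP\pmod 4=\mathrm{diag}\Big(r'\begin{pmatrix}2&1\\1&2\end{pmatrix}, (r+s-r')\begin{pmatrix}0&1\\1&0\end{pmatrix}, t\begin{pmatrix}0&2\\2&0\end{pmatrix}, p(2), m(0)\Big).$$ In particular, $A$ has a normal form in which the parameter $r$ equals $0$.
   Context: "$M\pmod 4$" is entrywise reduction into $\{0,1,2,3\}$; $\mathrm{diag}(\dots)$ with multiplicities denotes the block diagonal matrix with the indicated numbers of copies of each block. A normal form of a symmetric integer matrix $A$ with even diagonal is a matrix $\mathrm{diag}\big(r\begin{pmatrix}2&1\\1&2\end{pmatrix}, s\begin{pmatrix}0&1\\1&0\end{pmatrix}, t\begin{pmatrix}0&2\\2&0\end{pmatrix}, p(2), m(0)\big)$ equal to $P^TAP\pmod 4$ for some integer $P$ with $\det P=\pm1$. -}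

module Defs where

open import Data.Nat as ℕ using (ℕ; zero; suc; _<?_; _≤?_)
open import Data.Integer as ℤ using (ℤ; +_; -_; _%ℕ_)
open import Data.Fin using (Fin; zero; suc; toℕ; punchIn)
open import Data.List using (List; []; _∷_; _++_; replicate; map)
open import Data.Nat.ListAction using (sum)
open import Relation.Binary.PropositionalEquality using (_≡_)
open import Data.Product using (_×_; _,_; proj₁)
open import Data.Bool using (if_then_else_)
open import Relation.Nullary.Decidable using (does)

Mat : ℕ → ℕ → Set
Mat m n = Fin m → Fin n → ℤ

Σ[<_] : ∀ n → (Fin n → ℤ) → ℤ
Σ[< zero ] f = + 0
Σ[< suc n ] f = f zero ℤ.+ Σ[< n ] (λ i → f (suc i))

_⊗_ : ∀ {l m n} → Mat l m → Mat m n → Mat l n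
_⊗_ {m = m} A B i k = Σ[< m ] (λ j → A i j ℤ.* B j k)

infixl 7 _⊗_

_ᵀ : ∀ {m n} → Mat m n → Mat n m
(A ᵀ) i j = A j i

Symmetric : ∀ {n} → Mat n n → Set
Symmetric A = ∀ i j → A i j ≡ A j i

sgn : ℕ → ℤ
sgn zero = + 1
sgn (suc k) = - sgn k

det : ∀ {n} → Mat n n → ℤ
det {zero} A = + 1
det {suc n} A =
  Σ[< suc n ] (λ j → sgn (toℕ j) ℤ.* (A zero j ℤ.* det (λ i k → A (suc i) (punchIn j k))))

-- Block-diagonal matrices, indexed by natural numbers
-- A block is its size k together with its entries (only i,j < k are used).

Block : Set
Block = ℕ × (ℕ → ℕ → ℤ)

blockDiag : List Block → ℕ → ℕ → ℤ
blockDiag [] i j = + 0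
blockDiag ((k , f) ∷ bs) i j =
  if does (i <? k) then (if does (j <? k) then f i j else + 0)
  else (if does (j <? k) then + 0 else blockDiag bs (i ℕ.∸ k) (j ℕ.∸ k))

blockSize : List Block → ℕ
blockSize bs = sum (map proj₁ bs)

mat2 : ℤ → ℤ → ℤ → ℤ → Block
mat2 a b c d = 2 , f
  where
  f : ℕ → ℕ → ℤ
  f 0 0 = a
  f 0 1 = b
  f 1 0 = c
  f 1 1 = d
  f _ _ = + 0

mat1 : ℤ → Block
mat1 a = 1 , f
  where
  f : ℕ → ℕ → ℤ
  f 0 0 = a
  f _ _ = + 0

nfBlocks : ℕ → ℕ → ℕ → ℕ → ℕ → List Block
nfBlocks r s t p m =
  replicate r (mat2 (+ 2) (+ 1) (+ 1) (+ 2)) ++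
  replicate s (mat2 (+ 0) (+ 1) (+ 1) (+ 0)) ++
  replicate t (mat2 (+ 0) (+ 2) (+ 2) (+ 0)) ++
  replicate p (mat1 (+ 2)) ++
  replicate m (mat1 (+ 0))

-- "M (mod 4) = diag(...)": M is n×n with n the total block size, and the
-- entrywise reduction of M into {0,1,2,3} equals the block-diagonal matrix.

Mod4Eq : ∀ {n} → Mat n n → List Block → Set
Mod4Eq {n} M bs =
  (n ≡ blockSize bs) ×
  (∀ i j → + (M i j %ℕ 4) ≡ blockDiag bs (toℕ i) (toℕ j))

Unimodular : ∀ {n} → Mat n n → Set
Unimodular P = (det P ≡ + 1) Data.Sum.⊎ (det P ≡ - (+ 1))
  where import Data.Sum

HasNormalForm : ∀ {n} → Mat n n → ℕ → ℕ → ℕ → ℕ → ℕ → Set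
HasNormalForm {n} A r s t p m =
  Data.Product.∃ λ (P : Mat n n) → Unimodular P × Mod4Eq (P ᵀ ⊗ A ⊗ P) (nfBlocks r s t p m)
  where import Data.Product

module Submission where

-- Modulo 4, A₂ ⊕ A₂ ≅ U ⊕ U and A₂ ⊕ ⟨2⟩ ≅ U ⊕ ⟨2⟩, where A₂ = (2 1; 1 2) and U = (0 1; 1 0);
-- both are witnessed by explicit unimodular matrices. To trade d blocks A₂ for U (or back),
-- convert them in pairs with the first congruence and, if d is odd, convert the last one
-- together with a block ⟨2⟩, which exists because p ≥ 1. That ⟨2⟩ is separated from A₂ by
-- other blocks, on which the transformation acts as the identity.
-- All pieces are assembled into a single matrix P, block diagonal up to these inserted
-- identities; so det P = ±1 follows from Laplace expansion alone (block lower triangular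
-- matrices, rows with one nonzero entry), and multiplicativity of det is never needed.

open import Defs
open import Data.Nat using (ℕ; _+_; _∸_; _≤_; _≥_)
open import Data.Product using (_×_; ∃)

open import Data.Nat as ℕ using (zero; suc; _<_; z≤n; s≤s; _<?_)
import Data.Nat.Properties as ℕ
open import Data.Integer as ℤ using (ℤ; +_; -_; _%ℕ_; -1ℤ; 0ℤ; 1ℤ)
import Data.Integer.Properties as ℤ
open import Data.Integer.DivMod using (a≡a%ℕn+[a/ℕn]*n; n%ℕd<d)
open import Data.Integer.Divisibility.Signed using (_∣_; divides; _∣?_; ∣m∣n⇒∣m+n; ∣m⇒∣-m; ∣m⇒∣m*n; ∣n⇒∣m*n)
open import Data.Integer.Tactic.RingSolver using (solve-∀)
open import Data.Fin as Fin using (Fin; toℕ)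
import Data.Fin.Properties as Fin
open import Data.Product using (_,_; proj₁; proj₂)
open import Data.Sum using (_⊎_; inj₁; inj₂; [_,_]′; map₂)
open import Data.Sum.Properties using (inj₂-injective)
open import Data.List using (List; []; _∷_; _++_; map; replicate)
import Data.List.Properties as List
open import Data.List.Relation.Unary.All using (All; []; _∷_)
open import Data.List.Relation.Unary.All.Properties using (++⁺; replicate⁺)
import Data.Nat.ListAction as ListAction
import Data.Nat.ListAction.Properties as ListAction
open import Function using (_∘_)
open import Relation.Binary.PropositionalEquality
open import Relation.Nullary using (Dec; yes; no; does; contradiction)
open import Relation.Nullary.Decidable using (True; toWitness; _→-dec_; map′; dec-true; dec-false)
open import Data.Bool using (true; false; if_then_else_)

-- Square matrices of any size n are functions on ℕ × ℕ; only the entries below n matter.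
Matrix : Set
Matrix = ℕ → ℕ → ℤ

sum : ℕ → (ℕ → ℤ) → ℤ
sum n f = Σ[< n ] (f ∘ toℕ)

sum-cong : ∀ n {f g : ℕ → ℤ} → (∀ i → i < n → f i ≡ g i) → sum n f ≡ sum n g
sum-cong zero    eq = refl
sum-cong (suc n) eq = cong₂ ℤ._+_ (eq 0 (s≤s z≤n)) (sum-cong n (λ i i<n → eq (suc i) (s≤s i<n)))

sum-zero : ∀ n {f : ℕ → ℤ} → (∀ i → i < n → f i ≡ + 0) → sum n f ≡ + 0
sum-zero n eq = trans (sum-cong n eq) (zeros n)
  where
  zeros : ∀ n → sum n (λ _ → + 0) ≡ + 0
  zeros zero    = refl
  zeros (suc n) = trans (ℤ.+-identityˡ _) (zeros n)

sum-split : ∀ a b (f : ℕ → ℤ) → sum (a + b) f ≡ sum a f ℤ.+ sum b (λ i → f (a + i))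
sum-split zero    b f = sym (ℤ.+-identityˡ _)
sum-split (suc a) b f = trans (cong (λ x → f 0 ℤ.+ x) (sum-split a b (f ∘ suc))) (sym (ℤ.+-assoc (f 0) _ _))

*-distribˡ-sum : ∀ n c (f : ℕ → ℤ) → c ℤ.* sum n f ≡ sum n (λ i → c ℤ.* f i)
*-distribˡ-sum zero    c f = ℤ.*-zeroʳ c
*-distribˡ-sum (suc n) c f =
  trans (ℤ.*-distribˡ-+ c (f 0) _) (cong (λ x → c ℤ.* f 0 ℤ.+ x) (*-distribˡ-sum n c (f ∘ suc)))

*-distribʳ-sum : ∀ n c (f : ℕ → ℤ) → sum n f ℤ.* c ≡ sum n (λ i → f i ℤ.* c)
*-distribʳ-sum zero    c f = refl
*-distribʳ-sum (suc n) c f =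
  trans (ℤ.*-distribʳ-+ c (f 0) _) (cong (λ x → f 0 ℤ.* c ℤ.+ x) (*-distribʳ-sum n c (f ∘ suc)))

sum-single : ∀ n c {f : ℕ → ℤ} → c < n → (∀ i → i < n → i ≢ c → f i ≡ + 0) → sum n f ≡ f c
sum-single (suc n) zero {f} c<n others =
  trans (cong (λ x → f 0 ℤ.+ x) (sum-zero n λ i i<n → others (suc i) (s≤s i<n) λ ())) (ℤ.+-identityʳ (f 0))
sum-single (suc n) (suc c) (s≤s c<n) others =
  trans (cong₂ ℤ._+_ (others 0 (s≤s z≤n) λ ()) refl)
        (trans (ℤ.+-identityˡ _)
               (sum-single n c c<n (λ i i<n i≢c → others (suc i) (s≤s i<n) (i≢c ∘ ℕ.suc-injective))))

infix 4 _≡₄_ _≡₄?_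
record _≡₄_ (x y : ℤ) : Set where
  constructor mod4
  field 4∣x-y : + 4 ∣ x ℤ.- y

_≡₄?_ : ∀ x y → Dec (x ≡₄ y)
x ≡₄? y = map′ mod4 _≡₄_.4∣x-y (+ 4 ∣? (x ℤ.- y))

≡₄-reflexive : ∀ {x y} → x ≡ y → x ≡₄ y
≡₄-reflexive {x} refl = mod4 (divides (+ 0) (ℤ.+-inverseʳ x))

≡₄-refl : ∀ {x} → x ≡₄ x
≡₄-refl = ≡₄-reflexive refl

≡₄-sym : ∀ {x y} → x ≡₄ y → y ≡₄ x
≡₄-sym {x} {y} (mod4 p) = mod4 (subst (+ 4 ∣_) (negate x y) (∣m⇒∣-m p))
  where
  negate : ∀ x y → - (x ℤ.- y) ≡ y ℤ.- x
  negate = solve-∀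

≡₄-trans : ∀ {x y z} → x ≡₄ y → y ≡₄ z → x ≡₄ z
≡₄-trans {x} {y} {z} (mod4 p) (mod4 q) = mod4 (subst (+ 4 ∣_) (telescope x y z) (∣m∣n⇒∣m+n p q))
  where
  telescope : ∀ x y z → (x ℤ.- y) ℤ.+ (y ℤ.- z) ≡ x ℤ.- z
  telescope = solve-∀

+-cong₄ : ∀ {x x′ y y′} → x ≡₄ x′ → y ≡₄ y′ → x ℤ.+ y ≡₄ x′ ℤ.+ y′
+-cong₄ {x} {x′} {y} {y′} (mod4 p) (mod4 q) = mod4 (subst (+ 4 ∣_) (regroup x x′ y y′) (∣m∣n⇒∣m+n p q))
  where
  regroup : ∀ x x′ y y′ → (x ℤ.- x′) ℤ.+ (y ℤ.- y′) ≡ (x ℤ.+ y) ℤ.- (x′ ℤ.+ y′)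
  regroup = solve-∀

*-congˡ₄ : ∀ c {x y} → x ≡₄ y → c ℤ.* x ≡₄ c ℤ.* y
*-congˡ₄ c {x} {y} (mod4 p) = mod4 (subst (+ 4 ∣_) (distrib c x y) (∣n⇒∣m*n c p))
  where
  distrib : ∀ c x y → c ℤ.* (x ℤ.- y) ≡ c ℤ.* x ℤ.- c ℤ.* y
  distrib = solve-∀

*-congʳ₄ : ∀ c {x y} → x ≡₄ y → x ℤ.* c ≡₄ y ℤ.* c
*-congʳ₄ c {x} {y} (mod4 p) = mod4 (subst (+ 4 ∣_) (distrib c x y) (∣m⇒∣m*n c p))
  where
  distrib : ∀ c x y → (x ℤ.- y) ℤ.* c ≡ x ℤ.* c ℤ.- y ℤ.* c
  distrib = solve-∀

Σ-cong₄ : ∀ n {f g : Fin n → ℤ} → (∀ i → f i ≡₄ g i) → Σ[< n ] f ≡₄ Σ[< n ] g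
Σ-cong₄ zero    eq = ≡₄-refl
Σ-cong₄ (suc n) eq = +-cong₄ (eq Fin.zero) (Σ-cong₄ n (eq ∘ Fin.suc))

≡₄-%ℕ4 : ∀ x → x ≡₄ + (x %ℕ 4)
≡₄-%ℕ4 x = mod4 (divides (x ℤ./ℕ 4) (subst (λ y → y ℤ.- + (x %ℕ 4) ≡ x ℤ./ℕ 4 ℤ.* + 4)
  (sym (a≡a%ℕn+[a/ℕn]*n x 4)) (cancel (+ (x %ℕ 4)) (x ℤ./ℕ 4 ℤ.* + 4))))
  where
  cancel : ∀ r s → r ℤ.+ s ℤ.- r ≡ s
  cancel = solve-∀

residues-distinct : ∀ {a b} → a < 4 → b < 4 → + a ≡₄ + b → a ≡ b
residues-distinct a<4 b<4 a≡b = subst₂ _≡_ (Fin.toℕ-fromℕ< a<4) (Fin.toℕ-fromℕ< b<4)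
  (cong toℕ (decided _ _ (subst₂ _≡₄_ (as-toℕ a<4) (as-toℕ b<4) a≡b)))
  where
  as-toℕ : ∀ {a} (a<4 : a < 4) → + a ≡ + toℕ (Fin.fromℕ< a<4)
  as-toℕ a<4 = cong +_ (sym (Fin.toℕ-fromℕ< a<4))
  decided : ∀ (a b : Fin 4) → + toℕ a ≡₄ + toℕ b → a ≡ b
  decided = toWitness {a? = Fin.all? λ a → Fin.all? λ b → (+ toℕ a ≡₄? + toℕ b) →-dec (a Fin.≟ b)} _

%ℕ4-cong : ∀ {x y} → x ≡₄ y → x %ℕ 4 ≡ y %ℕ 4
%ℕ4-cong {x} {y} x≡y = residues-distinct (n%ℕd<d x 4) (n%ℕd<d y 4)
  (≡₄-trans (≡₄-trans (≡₄-sym (≡₄-%ℕ4 x)) x≡y) (≡₄-%ℕ4 y))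

detN : ℕ → Matrix → ℤ
detN n f = det {n} (λ a b → f (toℕ a) (toℕ b))

Σ-cong : ∀ n {f g : Fin n → ℤ} → (∀ i → f i ≡ g i) → Σ[< n ] f ≡ Σ[< n ] g
Σ-cong zero    eq = refl
Σ-cong (suc n) eq = cong₂ ℤ._+_ (eq Fin.zero) (Σ-cong n (eq ∘ Fin.suc))

det-cong : ∀ n {A B : Mat n n} → (∀ a b → A a b ≡ B a b) → det A ≡ det B
det-cong zero    eq = refl
det-cong (suc n) eq = Σ-cong (suc n) (λ j → cong₂ (λ x y → sgn (toℕ j) ℤ.* (x ℤ.* y))
  (eq Fin.zero j) (det-cong n (λ a b → eq (Fin.suc a) (Fin.punchIn j b))))

detN-cong : ∀ n {f g : Matrix} → (∀ i j → i < n → j < n → f i j ≡ g i j) → detN n f ≡ detN n g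
detN-cong n eq = det-cong n (λ a b → eq (toℕ a) (toℕ b) (Fin.toℕ<n a) (Fin.toℕ<n b))

punchInℕ : ℕ → ℕ → ℕ
punchInℕ zero    a       = suc a
punchInℕ (suc r) zero    = zero
punchInℕ (suc r) (suc a) = suc (punchInℕ r a)

punchOutℕ : ℕ → ℕ → ℕ
punchOutℕ zero    c       = ℕ.pred c
punchOutℕ (suc j) zero    = zero
punchOutℕ (suc j) (suc c) = suc (punchOutℕ j c)

toℕ-punchIn : ∀ {n} (j : Fin (suc n)) (k : Fin n) → toℕ (Fin.punchIn j k) ≡ punchInℕ (toℕ j) (toℕ k)
toℕ-punchIn Fin.zero    k          = refl
toℕ-punchIn (Fin.suc j) Fin.zero    = refl
toℕ-punchIn (Fin.suc j) (Fin.suc k) = cong suc (toℕ-punchIn j k)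

punchInℕ-≢ : ∀ c b → punchInℕ c b ≢ c
punchInℕ-≢ (suc c) (suc b) eq = punchInℕ-≢ c b (ℕ.suc-injective eq)

punchInℕ-injective : ∀ c {a b} → punchInℕ c a ≡ punchInℕ c b → a ≡ b
punchInℕ-injective zero    eq = ℕ.suc-injective eq
punchInℕ-injective (suc c) {zero}  {zero}  eq = refl
punchInℕ-injective (suc c) {suc a} {suc b} eq = cong suc (punchInℕ-injective c (ℕ.suc-injective eq))

punchInℕ-punchOutℕ : ∀ {j c} → c ≢ j → punchInℕ j (punchOutℕ j c) ≡ c
punchInℕ-punchOutℕ {zero}  {zero}  c≢j = contradiction refl c≢j
punchInℕ-punchOutℕ {zero}  {suc c} c≢j = refl
punchInℕ-punchOutℕ {suc j} {zero}  c≢j = refl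
punchInℕ-punchOutℕ {suc j} {suc c} c≢j = cong suc (punchInℕ-punchOutℕ (c≢j ∘ cong suc))

punchOutℕ-punchInℕ-≤ : ∀ {c j N} → c ≤ suc N → j ≤ N → punchOutℕ (punchInℕ c j) c ≤ N
punchOutℕ-punchInℕ-≤ {zero}                    c≤ j≤ = z≤n
punchOutℕ-punchInℕ-≤ {suc c} {zero}  {N}       (s≤s c≤) j≤ = c≤
punchOutℕ-punchInℕ-≤ {suc c} {suc j} {suc N}   (s≤s c≤) (s≤s j≤) = s≤s (punchOutℕ-punchInℕ-≤ c≤ j≤)

punchInℕ-punchInℕ : ∀ c j b →
  punchInℕ (punchInℕ c j) (punchInℕ (punchOutℕ (punchInℕ c j) c) b) ≡ punchInℕ c (punchInℕ j b)
punchInℕ-punchInℕ zero    j       b       = refl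
punchInℕ-punchInℕ (suc c) zero    b       = refl
punchInℕ-punchInℕ (suc c) (suc j) zero    = refl
punchInℕ-punchInℕ (suc c) (suc j) (suc b) = cong suc (punchInℕ-punchInℕ c j b)

punchInℕ-≥ : ∀ {j b} → j ≤ b → punchInℕ j b ≡ suc b
punchInℕ-≥ {zero}  j≤b       = refl
punchInℕ-≥ {suc j} (s≤s j≤b) = cong suc (punchInℕ-≥ j≤b)

punchInℕ-< : ∀ {j b} → b < j → punchInℕ j b ≡ b
punchInℕ-< {suc j} {zero}  b<j       = refl
punchInℕ-< {suc j} {suc b} (s≤s b<j) = cong suc (punchInℕ-< b<j)

sgn-+ : ∀ a b → sgn (a + b) ≡ sgn a ℤ.* sgn b
sgn-+ zero    b = sym (ℤ.*-identityˡ (sgn b))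
sgn-+ (suc a) b = trans (cong -_ (sgn-+ a b)) (ℤ.neg-distribˡ-* (sgn a) (sgn b))

sgn-punchInℕ : ∀ c j → sgn (punchInℕ c j + punchOutℕ (punchInℕ c j) c) ≡ - sgn (c + j)
sgn-punchInℕ zero    j       = cong (λ k → - sgn k) (ℕ.+-identityʳ j)
sgn-punchInℕ (suc c) zero    = sym (trans (ℤ.neg-involutive _) (cong sgn (ℕ.+-identityʳ c)))
sgn-punchInℕ (suc c) (suc j) = begin
  sgn (suc (punchInℕ c j) + suc (punchOutℕ (punchInℕ c j) c)) ≡⟨ cong (λ k → sgn (suc k)) (ℕ.+-suc (punchInℕ c j) _) ⟩
  - - sgn (punchInℕ c j + punchOutℕ (punchInℕ c j) c)        ≡⟨ ℤ.neg-involutive _ ⟩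
  sgn (punchInℕ c j + punchOutℕ (punchInℕ c j) c)            ≡⟨ sgn-punchInℕ c j ⟩
  - sgn (c + j)                                               ≡⟨ cong -_ (ℤ.neg-involutive _) ⟨
  - - - sgn (c + j)                                           ≡⟨ cong (λ k → - sgn (suc k)) (ℕ.+-suc c j) ⟨
  - sgn (suc c + suc j)                                       ∎
  where open ≡-Reasoning

sgn-punchInℕ-cancel : ∀ r c j′ → let j = punchInℕ c j′ in
  sgn j ℤ.* sgn (r + punchOutℕ j c) ≡ sgn (suc r + c) ℤ.* sgn j′
sgn-punchInℕ-cancel r c j′ = begin
  sgn j ℤ.* sgn (r + u)             ≡⟨ cong (sgn j ℤ.*_) (sgn-+ r u) ⟩
  sgn j ℤ.* (sgn r ℤ.* sgn u)       ≡⟨ commute (sgn j) (sgn r) (sgn u) ⟩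
  sgn r ℤ.* (sgn j ℤ.* sgn u)       ≡⟨ cong (sgn r ℤ.*_) (sgn-+ j u) ⟨
  sgn r ℤ.* sgn (j + u)             ≡⟨ cong (sgn r ℤ.*_) (sgn-punchInℕ c j′) ⟩
  sgn r ℤ.* - sgn (c + j′)          ≡⟨ cong (λ x → sgn r ℤ.* - x) (sgn-+ c j′) ⟩
  sgn r ℤ.* - (sgn c ℤ.* sgn j′)    ≡⟨ pull-neg (sgn r) (sgn c) (sgn j′) ⟩
  - (sgn r ℤ.* sgn c) ℤ.* sgn j′    ≡⟨ cong (λ x → - x ℤ.* sgn j′) (sgn-+ r c) ⟨
  - sgn (r + c) ℤ.* sgn j′          ∎
  where
  open ≡-Reasoning
  j = punchInℕ c j′
  u = punchOutℕ j c
  commute : ∀ a b c → a ℤ.* (b ℤ.* c) ≡ b ℤ.* (a ℤ.* c)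
  commute = solve-∀
  pull-neg : ∀ a b c → a ℤ.* - (b ℤ.* c) ≡ - (a ℤ.* b) ℤ.* c
  pull-neg = solve-∀

sgn-double : ∀ k → sgn (k + k) ≡ + 1
sgn-double zero    = refl
sgn-double (suc k) = trans (cong (λ n → - sgn n) (ℕ.+-suc k k)) (trans (ℤ.neg-involutive _) (sgn-double k))

sum-punchInℕ : ∀ N c (h : ℕ → ℤ) → c ≤ N → sum (suc N) h ≡ h c ℤ.+ sum N (h ∘ punchInℕ c)
sum-punchInℕ N       zero    h c≤N = refl
sum-punchInℕ (suc N) (suc c) h (s≤s c≤N) =
  trans (cong (λ x → h 0 ℤ.+ x) (sum-punchInℕ N c (h ∘ suc) c≤N)) (swap (h 0) (h (suc c)) _)
  where
  swap : ∀ a b s → a ℤ.+ (b ℤ.+ s) ≡ b ℤ.+ (a ℤ.+ s)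
  swap = solve-∀

minor : ℕ → ℕ → Matrix → Matrix
minor r c f a b = f (punchInℕ r a) (punchInℕ c b)

detN-expand : ∀ n f → detN (suc n) f ≡ sum (suc n) (λ j → sgn j ℤ.* (f 0 j ℤ.* detN n (minor 0 j f)))
detN-expand n f = Σ-cong (suc n) (λ j → cong (λ x → sgn (toℕ j) ℤ.* (f 0 (toℕ j) ℤ.* x))
  (det-cong n (λ a b → cong (f (suc (toℕ a))) (toℕ-punchIn j b))))

detN-expand-single-row : ∀ n r c (f : Matrix) → r ≤ n → c ≤ n → (∀ j → j ≢ c → f r j ≡ + 0) →
  detN (suc n) f ≡ sgn (r + c) ℤ.* (f r c ℤ.* detN n (minor r c f))
detN-expand-single-row n zero c f _ c≤n others = trans (detN-expand n f)
  (sum-single (suc n) c (s≤s c≤n) λ j _ j≢c → begin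
    sgn j ℤ.* (f 0 j ℤ.* detN n (minor 0 j f)) ≡⟨ cong (λ x → sgn j ℤ.* (x ℤ.* detN n (minor 0 j f))) (others j j≢c) ⟩
    sgn j ℤ.* (+ 0 ℤ.* detN n (minor 0 j f))   ≡⟨ ℤ.*-zeroʳ (sgn j) ⟩
    + 0                                         ∎)
  where open ≡-Reasoning
-- Expand along row 0: the term at column c vanishes, the others are expanded along row r by
-- induction, and reindexing j = punchInℕ c j′ regroups them into the row-0 expansion of the minor.
detN-expand-single-row (suc n) (suc r) c f (s≤s r≤n) c≤n others = begin
  detN (suc (suc n)) f
    ≡⟨ detN-expand (suc n) f ⟩
  sum (suc (suc n)) term
    ≡⟨ sum-punchInℕ (suc n) c term c≤n ⟩
  term c ℤ.+ sum (suc n) (term ∘ punchInℕ c)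
    ≡⟨ cong₂ ℤ._+_ term-c (sum-cong (suc n) term-punchIn) ⟩
  + 0 ℤ.+ sum (suc n) (λ j′ → s ℤ.* (frc ℤ.* expansion j′))
    ≡⟨ ℤ.+-identityˡ _ ⟩
  sum (suc n) (λ j′ → s ℤ.* (frc ℤ.* expansion j′))
    ≡⟨ trans (cong (s ℤ.*_) (*-distribˡ-sum (suc n) frc expansion))
             (*-distribˡ-sum (suc n) s (λ j′ → frc ℤ.* expansion j′)) ⟨
  s ℤ.* (frc ℤ.* sum (suc n) expansion)
    ≡⟨ cong (λ x → s ℤ.* (frc ℤ.* x)) (detN-expand n (minor (suc r) c f)) ⟨
  s ℤ.* (frc ℤ.* detN (suc n) (minor (suc r) c f)) ∎
  where
  open ≡-Reasoning
  s = sgn (suc r + c)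
  frc = f (suc r) c
  term : ℕ → ℤ
  term j = sgn j ℤ.* (f 0 j ℤ.* detN (suc n) (minor 0 j f))
  expansion : ℕ → ℤ
  expansion j′ = sgn j′ ℤ.* (f 0 (punchInℕ c j′) ℤ.* detN n (minor 0 j′ (minor (suc r) c f)))

  -- Row r of minor 0 c f vanishes, so the induction hypothesis, taken at column 0, gives 0.
  term-c : term c ≡ + 0
  term-c = begin
    sgn c ℤ.* (f 0 c ℤ.* detN (suc n) (minor 0 c f))
      ≡⟨ cong (λ x → sgn c ℤ.* (f 0 c ℤ.* x)) (detN-expand-single-row n r 0 (minor 0 c f) r≤n z≤n
           λ b _ → others (punchInℕ c b) (punchInℕ-≢ c b)) ⟩
    sgn c ℤ.* (f 0 c ℤ.* (sgn (r + 0) ℤ.* (f (suc r) (punchInℕ c 0) ℤ.* D)))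
      ≡⟨ cong (λ x → sgn c ℤ.* (f 0 c ℤ.* (sgn (r + 0) ℤ.* (x ℤ.* D)))) (others _ (punchInℕ-≢ c 0)) ⟩
    sgn c ℤ.* (f 0 c ℤ.* (sgn (r + 0) ℤ.* (+ 0 ℤ.* D)))
      ≡⟨ annihilate (sgn c) (f 0 c) (sgn (r + 0)) D ⟩
    + 0 ∎
    where
    D = detN n (minor r 0 (minor 0 c f))
    annihilate : ∀ a b c d → a ℤ.* (b ℤ.* (c ℤ.* (+ 0 ℤ.* d))) ≡ + 0
    annihilate = solve-∀

  term-punchIn : ∀ j′ → j′ < suc n → term (punchInℕ c j′) ≡ s ℤ.* (frc ℤ.* expansion j′)
  term-punchIn j′ (s≤s j′≤n) = begin
    sgn j ℤ.* (f 0 j ℤ.* detN (suc n) (minor 0 j f))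
      ≡⟨ cong (λ x → sgn j ℤ.* (f 0 j ℤ.* x)) inner ⟩
    sgn j ℤ.* (f 0 j ℤ.* (sgn (r + u) ℤ.* (frc ℤ.* D)))
      ≡⟨ shuffle (sgn j) (sgn (r + u)) (f 0 j) frc D ⟩
    (sgn j ℤ.* sgn (r + u)) ℤ.* (frc ℤ.* (f 0 j ℤ.* D))
      ≡⟨ cong (ℤ._* (frc ℤ.* (f 0 j ℤ.* D))) (sgn-punchInℕ-cancel r c j′) ⟩
    (s ℤ.* sgn j′) ℤ.* (frc ℤ.* (f 0 j ℤ.* D))
      ≡⟨ unshuffle s (sgn j′) (f 0 j) frc D ⟩
    s ℤ.* (frc ℤ.* expansion j′) ∎
    where
    j = punchInℕ c j′
    u = punchOutℕ j c
    D = detN n (minor 0 j′ (minor (suc r) c f))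
    c≢j : c ≢ j
    c≢j = punchInℕ-≢ c j′ ∘ sym
    inner : detN (suc n) (minor 0 j f) ≡ sgn (r + u) ℤ.* (frc ℤ.* D)
    inner = trans
      (detN-expand-single-row n r u (minor 0 j f) r≤n (punchOutℕ-punchInℕ-≤ c≤n j′≤n)
        λ b b≢u → others (punchInℕ j b) λ eq →
          b≢u (punchInℕ-injective j (trans eq (sym (punchInℕ-punchOutℕ c≢j)))))
      (cong₂ (λ x y → sgn (r + u) ℤ.* (x ℤ.* y))
        (cong (f (suc r)) (punchInℕ-punchOutℕ c≢j))
        (detN-cong n λ a b _ _ → cong (f (suc (punchInℕ r a))) (punchInℕ-punchInℕ c j′ b)))
    shuffle : ∀ a b x y z → a ℤ.* (x ℤ.* (b ℤ.* (y ℤ.* z))) ≡ (a ℤ.* b) ℤ.* (y ℤ.* (x ℤ.* z))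
    shuffle = solve-∀
    unshuffle : ∀ a b x y z → (a ℤ.* b) ℤ.* (y ℤ.* (x ℤ.* z)) ≡ a ℤ.* (y ℤ.* (b ℤ.* (x ℤ.* z)))
    unshuffle = solve-∀

detN-blockLowerTriangular : ∀ k n f → (∀ i j → i < k → j < n → f i (k + j) ≡ + 0) →
  detN (k + n) f ≡ detN k f ℤ.* detN n (λ i j → f (k + i) (k + j))
detN-blockLowerTriangular zero    n f _     = sym (ℤ.*-identityˡ _)
detN-blockLowerTriangular (suc k) n f upper = begin
  detN (suc k + n) f
    ≡⟨ detN-expand (k + n) f ⟩
  sum (suc k + n) term
    ≡⟨ sum-split (suc k) n term ⟩
  sum (suc k) term ℤ.+ sum n (λ j → term (suc k + j))
    ≡⟨ cong₂ ℤ._+_ (sum-cong (suc k) term-factor) (sum-zero n term-right) ⟩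
  sum (suc k) (λ j → topTerm j ℤ.* detN n C) ℤ.+ + 0
    ≡⟨ ℤ.+-identityʳ _ ⟩
  sum (suc k) (λ j → topTerm j ℤ.* detN n C)
    ≡⟨ *-distribʳ-sum (suc k) (detN n C) topTerm ⟨
  sum (suc k) topTerm ℤ.* detN n C
    ≡⟨ cong (ℤ._* detN n C) (detN-expand k f) ⟨
  detN (suc k) f ℤ.* detN n C ∎
  where
  open ≡-Reasoning
  C : Matrix
  C i j = f (suc k + i) (suc k + j)
  term topTerm : ℕ → ℤ
  term j = sgn j ℤ.* (f 0 j ℤ.* detN (k + n) (minor 0 j f))
  topTerm j = sgn j ℤ.* (f 0 j ℤ.* detN k (minor 0 j f))

  term-right : ∀ j → j < n → term (suc k + j) ≡ + 0
  term-right j j<n = begin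
    sgn (suc k + j) ℤ.* (f 0 (suc k + j) ℤ.* D)
      ≡⟨ cong (λ x → sgn (suc k + j) ℤ.* (x ℤ.* D)) (upper 0 j (s≤s z≤n) j<n) ⟩
    sgn (suc k + j) ℤ.* (+ 0 ℤ.* D)             ≡⟨ ℤ.*-zeroʳ (sgn (suc k + j)) ⟩
    + 0 ∎
    where D = detN (k + n) (minor 0 (suc k + j) f)

  term-factor : ∀ j → j < suc k → term j ≡ topTerm j ℤ.* detN n C
  term-factor j (s≤s j≤k) = begin
    sgn j ℤ.* (f 0 j ℤ.* detN (k + n) (minor 0 j f))
      ≡⟨ cong (λ x → sgn j ℤ.* (f 0 j ℤ.* x)) (detN-blockLowerTriangular k n (minor 0 j f)
           λ a b a<k b<n → trans (cong (f (suc a)) (punchInℕ-≥ (ℕ.≤-trans j≤k (ℕ.m≤m+n k b))))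
                                 (upper (suc a) b (s≤s a<k) b<n)) ⟩
    sgn j ℤ.* (f 0 j ℤ.* (detN k (minor 0 j f) ℤ.* detN n (λ a b → minor 0 j f (k + a) (k + b))))
      ≡⟨ cong (λ x → sgn j ℤ.* (f 0 j ℤ.* (detN k (minor 0 j f) ℤ.* x)))
           (detN-cong n λ a b _ _ → cong (f (suc k + a)) (punchInℕ-≥ (ℕ.≤-trans j≤k (ℕ.m≤m+n k b)))) ⟩
    sgn j ℤ.* (f 0 j ℤ.* (detN k (minor 0 j f) ℤ.* detN n C))
      ≡⟨ reassoc (sgn j) (f 0 j) _ _ ⟩
    topTerm j ℤ.* detN n C ∎
    where
    reassoc : ∀ s x y z → s ℤ.* (x ℤ.* (y ℤ.* z)) ≡ s ℤ.* (x ℤ.* y) ℤ.* z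
    reassoc = solve-∀

δ : Matrix
δ zero    zero    = + 1
δ zero    (suc _) = + 0
δ (suc _) zero    = + 0
δ (suc i) (suc j) = δ i j

δ-≢ : ∀ {i j} → i ≢ j → δ i j ≡ + 0
δ-≢ {zero}  {zero}  i≢j = contradiction refl i≢j
δ-≢ {zero}  {suc j} i≢j = refl
δ-≢ {suc i} {zero}  i≢j = refl
δ-≢ {suc i} {suc j} i≢j = δ-≢ (i≢j ∘ cong suc)

δ-refl : ∀ i → δ i i ≡ + 1
δ-refl zero    = refl
δ-refl (suc i) = δ-refl i

detN-δ : ∀ n → detN n δ ≡ + 1
detN-δ zero    = refl
detN-δ (suc n) = begin
  detN (suc n) δ                         ≡⟨ detN-expand-single-row n 0 0 δ z≤n z≤n first-row ⟩
  + 1 ℤ.* (+ 1 ℤ.* detN n (minor 0 0 δ)) ≡⟨ trans (ℤ.*-identityˡ _) (ℤ.*-identityˡ _) ⟩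
  detN n δ                               ≡⟨ detN-δ n ⟩
  + 1                                    ∎
  where
  open ≡-Reasoning
  first-row : ∀ j → j ≢ 0 → δ 0 j ≡ + 0
  first-row j j≢0 = δ-≢ (j≢0 ∘ sym)

IsUnit : ℤ → Set
IsUnit x = x ≡ + 1 ⊎ x ≡ - + 1

IsUnit-* : ∀ {x y} → IsUnit x → IsUnit y → IsUnit (x ℤ.* y)
IsUnit-* (inj₁ refl) (inj₁ refl) = inj₁ refl
IsUnit-* (inj₁ refl) (inj₂ refl) = inj₂ refl
IsUnit-* (inj₂ refl) (inj₁ refl) = inj₂ refl
IsUnit-* (inj₂ refl) (inj₂ refl) = inj₁ refl

-- The direct sum of A and B with coordinates ℕ ⊎ ℕ; side and region below lay these
-- coordinates out on ℕ.
_⊎ₘ_ : Matrix → Matrix → ℕ ⊎ ℕ → ℕ ⊎ ℕ → ℤ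
(A ⊎ₘ B) (inj₁ a) (inj₁ b) = A a b
(A ⊎ₘ B) (inj₂ a) (inj₂ b) = B a b
(A ⊎ₘ B) (inj₁ _) (inj₂ _) = + 0
(A ⊎ₘ B) (inj₂ _) (inj₁ _) = + 0

side : ℕ → ℕ → ℕ ⊎ ℕ
side k i = if does (i <? k) then inj₁ i else inj₂ (i ∸ k)

side-< : ∀ {k i} → i < k → side k i ≡ inj₁ i
side-< {k} {i} i<k rewrite dec-true (i <? k) i<k = refl

side-+ : ∀ k i → side k (k + i) ≡ inj₂ i
side-+ k i rewrite dec-false (k + i <? k) (ℕ.≤⇒≯ (ℕ.m≤m+n k i)) = cong inj₂ (ℕ.m+n∸m≡n k i)

data Side (k : ℕ) : ℕ → Set where
  below  : ∀ {i} → i < k → Side k i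
  beyond : ∀ i → Side k (k + i)

side-view : ∀ k i → Side k i
side-view k i with i <? k
... | yes i<k = below i<k
... | no  i≮k = subst (Side k) (ℕ.m+[n∸m]≡n (ℕ.≮⇒≥ i≮k)) (beyond (i ∸ k))

-- Literally the recursion step of blockDiag: blockDiag ((k , A) ∷ L) is A ⊕[ k ] blockDiag L.
infixr 5 _⊕[_]_
_⊕[_]_ : Matrix → ℕ → Matrix → Matrix
(A ⊕[ k ] B) i j =
  if does (i <? k) then (if does (j <? k) then A i j else + 0)
  else (if does (j <? k) then + 0 else B (i ∸ k) (j ∸ k))

⊕-⊎ₘ : ∀ A k B i j → (A ⊕[ k ] B) i j ≡ (A ⊎ₘ B) (side k i) (side k j)
⊕-⊎ₘ A k B i j with does (i <? k) | does (j <? k)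
... | true  | true  = refl
... | true  | false = refl
... | false | true  = refl
... | false | false = refl

module _ (A : Matrix) (k : ℕ) (B : Matrix) where

  ⊕-<< : ∀ {i j} → i < k → j < k → (A ⊕[ k ] B) i j ≡ A i j
  ⊕-<< {i} {j} i<k j<k = trans (⊕-⊎ₘ A k B i j) (cong₂ (A ⊎ₘ B) (side-< i<k) (side-< j<k))

  ⊕-<+ : ∀ {i} j → i < k → (A ⊕[ k ] B) i (k + j) ≡ + 0
  ⊕-<+ {i} j i<k = trans (⊕-⊎ₘ A k B i (k + j)) (cong₂ (A ⊎ₘ B) (side-< i<k) (side-+ k j))

  ⊕-+< : ∀ i {j} → j < k → (A ⊕[ k ] B) (k + i) j ≡ + 0
  ⊕-+< i {j} j<k = trans (⊕-⊎ₘ A k B (k + i) j) (cong₂ (A ⊎ₘ B) (side-+ k i) (side-< j<k))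

  ⊕-++ : ∀ i j → (A ⊕[ k ] B) (k + i) (k + j) ≡ B i j
  ⊕-++ i j = trans (⊕-⊎ₘ A k B (k + i) (k + j)) (cong₂ (A ⊎ₘ B) (side-+ k i) (side-+ k j))

⊕-congʳ : ∀ A k {B B′} → (∀ i j → B i j ≡ B′ i j) → ∀ i j → (A ⊕[ k ] B) i j ≡ (A ⊕[ k ] B′) i j
⊕-congʳ A k {B} {B′} eq i j = begin
  (A ⊕[ k ] B) i j                    ≡⟨ ⊕-⊎ₘ A k B i j ⟩
  (A ⊎ₘ B) (side k i) (side k j)      ≡⟨ pointwise (side k i) (side k j) ⟩
  (A ⊎ₘ B′) (side k i) (side k j)     ≡⟨ ⊕-⊎ₘ A k B′ i j ⟨
  (A ⊕[ k ] B′) i j                   ∎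
  where
  open ≡-Reasoning
  pointwise : ∀ x y → (A ⊎ₘ B) x y ≡ (A ⊎ₘ B′) x y
  pointwise (inj₁ a) (inj₁ b) = refl
  pointwise (inj₁ a) (inj₂ b) = refl
  pointwise (inj₂ a) (inj₁ b) = refl
  pointwise (inj₂ a) (inj₂ b) = eq a b

module _ (A : Matrix) (a : ℕ) (B : Matrix) (b : ℕ) (C : Matrix) where
  private
    AB BC ABC : Matrix
    AB  = A ⊕[ a ] B
    BC  = B ⊕[ b ] C
    ABC = AB ⊕[ a + b ] C
    widen : ∀ {x} → x < a → x < a + b
    widen = ℕ.m≤n⇒m≤n+o b

  ⊕-assoc : ∀ i j → ((A ⊕[ a ] B) ⊕[ a + b ] C) i j ≡ (A ⊕[ a ] (B ⊕[ b ] C)) i j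
  ⊕-assoc i j with side-view a i | side-view a j
  ... | below i<a | below j<a =
    trans (⊕-<< AB (a + b) C (widen i<a) (widen j<a)) (trans (⊕-<< A a B i<a j<a) (sym (⊕-<< A a BC i<a j<a)))
  ... | below i<a | beyond j with side-view b j
  ...   | below j<b = trans (⊕-<< AB (a + b) C (widen i<a) (ℕ.+-monoʳ-< a j<b))
                        (trans (⊕-<+ A a B j i<a) (sym (⊕-<+ A a BC j i<a)))
  ...   | beyond j′ = trans (cong (ABC i) (sym (ℕ.+-assoc a b j′)))
                        (trans (⊕-<+ AB (a + b) C j′ (widen i<a)) (sym (⊕-<+ A a BC (b + j′) i<a)))
  ⊕-assoc _ j | beyond i | below j<a with side-view b i
  ...   | below i<b = trans (⊕-<< AB (a + b) C (ℕ.+-monoʳ-< a i<b) (widen j<a))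
                        (trans (⊕-+< A a B i j<a) (sym (⊕-+< A a BC i j<a)))
  ...   | beyond i′ = trans (cong (λ x → ABC x j) (sym (ℕ.+-assoc a b i′)))
                        (trans (⊕-+< AB (a + b) C i′ (widen j<a)) (sym (⊕-+< A a BC (b + i′) j<a)))
  ⊕-assoc _ _ | beyond i | beyond j with side-view b i | side-view b j
  ...   | below i<b | below j<b = trans (⊕-<< AB (a + b) C (ℕ.+-monoʳ-< a i<b) (ℕ.+-monoʳ-< a j<b))
                                    (trans (⊕-++ A a B i j) (sym (trans (⊕-++ A a BC i j) (⊕-<< B b C i<b j<b))))
  ...   | below i<b | beyond j′ = trans (cong (ABC (a + i)) (sym (ℕ.+-assoc a b j′)))
                                    (trans (⊕-<+ AB (a + b) C j′ (ℕ.+-monoʳ-< a i<b))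
                                           (sym (trans (⊕-++ A a BC i (b + j′)) (⊕-<+ B b C j′ i<b))))
  ...   | beyond i′ | below j<b = trans (cong (λ x → ABC x (a + j)) (sym (ℕ.+-assoc a b i′)))
                                    (trans (⊕-+< AB (a + b) C i′ (ℕ.+-monoʳ-< a j<b))
                                           (sym (trans (⊕-++ A a BC (b + i′) j) (⊕-+< B b C i′ j<b))))
  ...   | beyond i′ | beyond j′ = trans (cong₂ ABC (sym (ℕ.+-assoc a b i′)) (sym (ℕ.+-assoc a b j′)))
                                    (trans (⊕-++ AB (a + b) C i′ j′)
                                           (sym (trans (⊕-++ A a BC (b + i′) (b + j′)) (⊕-++ B b C i′ j′))))

blockSize-++ : ∀ L₁ L₂ → blockSize (L₁ ++ L₂) ≡ blockSize L₁ + blockSize L₂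
blockSize-++ L₁ L₂ = trans (cong ListAction.sum (List.map-++ proj₁ L₁ L₂)) (ListAction.sum-++ (map proj₁ L₁) _)

blockDiag-++ : ∀ L₁ L₂ i j → blockDiag (L₁ ++ L₂) i j ≡ (blockDiag L₁ ⊕[ blockSize L₁ ] blockDiag L₂) i j
blockDiag-++ []             L₂ i j = refl
blockDiag-++ ((k , f) ∷ L₁) L₂ i j =
  trans (⊕-congʳ f k (blockDiag-++ L₁ L₂) i j) (sym (⊕-assoc f k (blockDiag L₁) (blockSize L₁) (blockDiag L₂) i j))

column : Matrix → ℕ → ℕ → ℤ
column P i a = P a i

form : ℕ → Matrix → (ℕ → ℤ) → (ℕ → ℤ) → ℤ
form n G u v = sum n (λ b → sum n (λ a → u a ℤ.* G a b) ℤ.* v b)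

form-cong : ∀ n G {u u′ v v′} → (∀ a → a < n → u a ≡ u′ a) → (∀ b → b < n → v b ≡ v′ b) →
  form n G u v ≡ form n G u′ v′
form-cong n G eqᵘ eqᵛ = sum-cong n λ b b<n →
  cong₂ ℤ._*_ (sum-cong n λ a a<n → cong (ℤ._* G a b) (eqᵘ a a<n)) (eqᵛ b b<n)

form-congᴳ : ∀ n {G G′} u v → (∀ a b → G a b ≡ G′ a b) → form n G u v ≡ form n G′ u v
form-congᴳ n u v eq = sum-cong n λ b _ →
  cong (ℤ._* v b) (sum-cong n λ a _ → cong (u a ℤ.*_) (eq a b))

form-zeroˡ : ∀ n G {u} v → (∀ a → a < n → u a ≡ + 0) → form n G u v ≡ + 0
form-zeroˡ n G {u} v u≡0 = sum-zero n λ b _ → trans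
  (cong (ℤ._* v b) (sum-zero n λ a a<n → cong (ℤ._* G a b) (u≡0 a a<n))) (ℤ.*-zeroˡ (v b))

form-zeroʳ : ∀ n G u {v} → (∀ b → b < n → v b ≡ + 0) → form n G u v ≡ + 0
form-zeroʳ n G u {v} v≡0 = sum-zero n λ b b<n → trans
  (cong (sum n (λ a → u a ℤ.* G a b) ℤ.*_) (v≡0 b b<n)) (ℤ.*-zeroʳ (sum n (λ a → u a ℤ.* G a b)))

form-⊕ : ∀ k n G H u v →
  form (k + n) (G ⊕[ k ] H) u v ≡ form k G u v ℤ.+ form n H (λ a → u (k + a)) (λ b → v (k + b))
form-⊕ k n G H u v = begin
  sum (k + n) (λ b → I b ℤ.* v b)
    ≡⟨ sum-split k n (λ b → I b ℤ.* v b) ⟩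
  sum k (λ b → I b ℤ.* v b) ℤ.+ sum n (λ b → I (k + b) ℤ.* v (k + b))
    ≡⟨ cong₂ ℤ._+_ (sum-cong k λ b b<k → cong (ℤ._* v b) (I-< b b<k))
                   (sum-cong n λ b _ → cong (ℤ._* v (k + b)) (I-+ b)) ⟩
  form k G u v ℤ.+ form n H (λ a → u (k + a)) (λ b → v (k + b)) ∎
  where
  open ≡-Reasoning
  I : ℕ → ℤ
  I b = sum (k + n) (λ a → u a ℤ.* (G ⊕[ k ] H) a b)
  I-< : ∀ b → b < k → I b ≡ sum k (λ a → u a ℤ.* G a b)
  I-< b b<k = begin
    I b
      ≡⟨ sum-split k n (λ a → u a ℤ.* (G ⊕[ k ] H) a b) ⟩
    sum k (λ a → u a ℤ.* (G ⊕[ k ] H) a b) ℤ.+ sum n (λ a → u (k + a) ℤ.* (G ⊕[ k ] H) (k + a) b)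
      ≡⟨ cong₂ ℤ._+_ (sum-cong k λ a a<k → cong (u a ℤ.*_) (⊕-<< G k H a<k b<k))
                     (sum-zero n λ a _ → trans (cong (u (k + a) ℤ.*_) (⊕-+< G k H a b<k)) (ℤ.*-zeroʳ (u (k + a)))) ⟩
    sum k (λ a → u a ℤ.* G a b) ℤ.+ + 0
      ≡⟨ ℤ.+-identityʳ _ ⟩
    sum k (λ a → u a ℤ.* G a b) ∎
  I-+ : ∀ b → I (k + b) ≡ sum n (λ a → u (k + a) ℤ.* H a b)
  I-+ b = begin
    I (k + b)
      ≡⟨ sum-split k n (λ a → u a ℤ.* (G ⊕[ k ] H) a (k + b)) ⟩
    sum k (λ a → u a ℤ.* (G ⊕[ k ] H) a (k + b)) ℤ.+ sum n (λ a → u (k + a) ℤ.* (G ⊕[ k ] H) (k + a) (k + b))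
      ≡⟨ cong₂ ℤ._+_ (sum-zero k λ a a<k → trans (cong (u a ℤ.*_) (⊕-<+ G k H b a<k)) (ℤ.*-zeroʳ (u a)))
                     (sum-cong n λ a _ → cong (u (k + a) ℤ.*_) (⊕-++ G k H a b)) ⟩
    + 0 ℤ.+ sum n (λ a → u (k + a) ℤ.* H a b)
      ≡⟨ ℤ.+-identityˡ _ ⟩
    sum n (λ a → u (k + a) ℤ.* H a b) ∎

form-δ : ∀ n G {i j} → i < n → j < n → form n G (column δ i) (column δ j) ≡ G i j
form-δ n G {i} {j} i<n j<n = begin
  sum n (λ b → sum n (λ a → δ a i ℤ.* G a b) ℤ.* δ b j)
    ≡⟨ sum-cong n (λ b _ → cong (ℤ._* δ b j) (trans (sum-single n i i<n λ a _ a≢i → trans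
         (cong (ℤ._* G a b) (δ-≢ a≢i)) refl) (trans (cong (ℤ._* G i b) (δ-refl i)) (ℤ.*-identityˡ _)))) ⟩
  sum n (λ b → G i b ℤ.* δ b j)
    ≡⟨ sum-single n j j<n (λ b _ b≢j → trans (cong (G i b ℤ.*_) (δ-≢ b≢j)) (ℤ.*-zeroʳ (G i b))) ⟩
  G i j ℤ.* δ j j
    ≡⟨ trans (cong (G i j ℤ.*_) (δ-refl j)) (ℤ.*-identityʳ _) ⟩
  G i j ∎
  where open ≡-Reasoning

record Congruent₄ (n : ℕ) (G G′ : Matrix) : Set where
  field
    P          : Matrix
    unimodular : IsUnit (detN n P)
    transforms : ∀ {i j} → i < n → j < n → form n G (column P i) (column P j) ≡₄ G′ i j

open Congruent₄

congruent₄-refl : ∀ n G → Congruent₄ n G G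
congruent₄-refl n G = record
  { P          = δ
  ; unimodular = inj₁ (detN-δ n)
  ; transforms = λ i<n j<n → ≡₄-reflexive (form-δ n G i<n j<n)
  }

congruent₄-resp : ∀ {n G₁ G₂ G₁′ G₂′} → (∀ i j → G₁ i j ≡ G₂ i j) → (∀ i j → G₁′ i j ≡ G₂′ i j) →
  Congruent₄ n G₁ G₁′ → Congruent₄ n G₂ G₂′
congruent₄-resp {n} eq eq′ C = record
  { P          = P C
  ; unimodular = unimodular C
  ; transforms = λ {i} {j} i<n j<n → ≡₄-trans
      (≡₄-reflexive (form-congᴳ n (column (P C) i) (column (P C) j) λ a b → sym (eq a b)))
      (≡₄-trans (transforms C i<n j<n) (≡₄-reflexive (eq′ i j)))
  }

congruent₄-reindex : ∀ {n n′ G G′ H H′} → n ≡ n′ → (∀ i j → G i j ≡ H i j) → (∀ i j → G′ i j ≡ H′ i j) →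
  Congruent₄ n G G′ → Congruent₄ n′ H H′
congruent₄-reindex refl eq eq′ = congruent₄-resp eq eq′

_∈[_,_] : ℕ ⊎ ℕ → ℕ → ℕ → Set
inj₁ i ∈[ a , b ] = i < a
inj₂ j ∈[ a , b ] = j < b

module _ {a b A A′ B B′} (CA : Congruent₄ a A A′) (CB : Congruent₄ b B B′) where

  ⊎ₘ-transforms : ∀ x y → x ∈[ a , b ] → y ∈[ a , b ] →
    form a A (λ c → (P CA ⊎ₘ P CB) (inj₁ c) x) (λ c → (P CA ⊎ₘ P CB) (inj₁ c) y) ℤ.+
    form b B (λ c → (P CA ⊎ₘ P CB) (inj₂ c) x) (λ c → (P CA ⊎ₘ P CB) (inj₂ c) y)
      ≡₄ (A′ ⊎ₘ B′) x y
  ⊎ₘ-transforms (inj₁ i) (inj₁ j) i<a j<a = ≡₄-trans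
    (≡₄-reflexive (trans (cong (λ z → form a A (column (P CA) i) (column (P CA) j) ℤ.+ z)
      (form-zeroʳ b B (λ _ → + 0) λ _ _ → refl)) (ℤ.+-identityʳ _)))
    (transforms CA i<a j<a)
  ⊎ₘ-transforms (inj₂ i) (inj₂ j) i<b j<b = ≡₄-trans
    (≡₄-reflexive (trans (cong (λ z → z ℤ.+ form b B (column (P CB) i) (column (P CB) j))
      (form-zeroʳ a A (λ _ → + 0) λ _ _ → refl)) (ℤ.+-identityˡ _)))
    (transforms CB i<b j<b)
  ⊎ₘ-transforms (inj₁ i) (inj₂ j) _ _ = ≡₄-reflexive
    (cong₂ ℤ._+_ (form-zeroʳ a A (column (P CA) i) λ _ _ → refl) (form-zeroˡ b B (column (P CB) j) λ _ _ → refl))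
  ⊎ₘ-transforms (inj₂ i) (inj₁ j) _ _ = ≡₄-reflexive
    (cong₂ ℤ._+_ (form-zeroˡ a A (column (P CA) j) λ _ _ → refl) (form-zeroʳ b B (column (P CB) i) λ _ _ → refl))

side-∈ : ∀ {k n i} → i < k + n → side k i ∈[ k , n ]
side-∈ {k} {n} {i} i<k+n with side-view k i
... | below i<k = subst (_∈[ k , n ]) (sym (side-< i<k)) i<k
... | beyond i′ = subst (_∈[ k , n ]) (sym (side-+ k i′)) (ℕ.+-cancelˡ-< k i′ n i<k+n)

congruent₄-⊕ : ∀ {k n G G′ H H′} → Congruent₄ k G G′ → Congruent₄ n H H′ →
  Congruent₄ (k + n) (G ⊕[ k ] H) (G′ ⊕[ k ] H′)
congruent₄-⊕ {k} {n} {G} {G′} {H} {H′} CG CH = record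
  { P          = Q
  ; unimodular = subst IsUnit (sym det-Q) (IsUnit-* (unimodular CG) (unimodular CH))
  ; transforms = λ {i} {j} i<k+n j<k+n → ≡₄-trans (≡₄-reflexive (split i j))
      (≡₄-trans (⊎ₘ-transforms CG CH (side k i) (side k j) (side-∈ i<k+n) (side-∈ j<k+n))
                (≡₄-reflexive (sym (⊕-⊎ₘ G′ k H′ i j))))
  }
  where
  Q : Matrix
  Q = P CG ⊕[ k ] P CH

  det-Q : detN (k + n) Q ≡ detN k (P CG) ℤ.* detN n (P CH)
  det-Q = trans (detN-blockLowerTriangular k n Q λ i j i<k _ → ⊕-<+ (P CG) k (P CH) j i<k)
    (cong₂ ℤ._*_ (detN-cong k λ i j i<k j<k → ⊕-<< (P CG) k (P CH) i<k j<k)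
                 (detN-cong n λ i j _ _ → ⊕-++ (P CG) k (P CH) i j))

  Q-< : ∀ {c} i → c < k → Q c i ≡ (P CG ⊎ₘ P CH) (inj₁ c) (side k i)
  Q-< {c} i c<k = trans (⊕-⊎ₘ (P CG) k (P CH) c i) (cong (λ x → (P CG ⊎ₘ P CH) x (side k i)) (side-< c<k))

  Q-+ : ∀ c i → Q (k + c) i ≡ (P CG ⊎ₘ P CH) (inj₂ c) (side k i)
  Q-+ c i = trans (⊕-⊎ₘ (P CG) k (P CH) (k + c) i) (cong (λ x → (P CG ⊎ₘ P CH) x (side k i)) (side-+ k c))

  split : ∀ i j → form (k + n) (G ⊕[ k ] H) (column Q i) (column Q j) ≡
    form k G (λ c → (P CG ⊎ₘ P CH) (inj₁ c) (side k i)) (λ c → (P CG ⊎ₘ P CH) (inj₁ c) (side k j)) ℤ.+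
    form n H (λ c → (P CG ⊎ₘ P CH) (inj₂ c) (side k i)) (λ c → (P CG ⊎ₘ P CH) (inj₂ c) (side k j))
  split i j = trans (form-⊕ k n G H (column Q i) (column Q j)) (cong₂ ℤ._+_
    (form-cong k G (λ c c<k → Q-< i c<k) (λ c c<k → Q-< j c<k))
    (form-cong n H (λ c _ → Q-+ c i) (λ c _ → Q-+ c j)))

-- Coordinates of G ⊕[ k ] (Mid ⊕[ M ] K): inj₁ for those of G ⊕[ k ] K, inj₂ for those of Mid.
region : ℕ → ℕ → ℕ → ℕ ⊎ ℕ
region k M i = [ inj₁ , (λ i′ → [ inj₂ , (λ r → inj₁ (k + r)) ]′ (side M i′)) ]′ (side k i)

module _ (k M : ℕ) where

  region-< : ∀ {i} → i < k → region k M i ≡ inj₁ i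
  region-< i<k rewrite side-< {k} i<k = refl

  region-inner : ∀ {m} → m < M → region k M (k + m) ≡ inj₂ m
  region-inner {m} m<M rewrite side-+ k m | side-< {M} m<M = refl

  region-outer : ∀ r → region k M (k + (M + r)) ≡ inj₁ (k + r)
  region-outer r rewrite side-+ k (M + r) | side-+ M r = refl

  region-∈ : ∀ {l i} → i < k + (M + l) → region k M i ∈[ k + l , M ]
  region-∈ {l} {i} i<n with side-view k i
  ... | below i<k = subst (_∈[ k + l , M ]) (sym (region-< i<k)) (ℕ.m≤n⇒m≤n+o l i<k)
  ... | beyond i′ with side-view M i′
  ...   | below i′<M = subst (_∈[ k + l , M ]) (sym (region-inner i′<M)) i′<M
  ...   | beyond r = subst (_∈[ k + l , M ]) (sym (region-outer r))
    (ℕ.+-monoʳ-< k (ℕ.+-cancelˡ-< M r l (ℕ.+-cancelˡ-< k (M + r) (M + l) i<n)))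

region-zero : ∀ k i → region k 0 i ≡ inj₁ i
region-zero k i with side-view k i
... | below i<k = region-< k 0 i<k
... | beyond r  = region-outer k 0 r

region-punchInℕ : ∀ k M a → region k (suc M) (punchInℕ k a) ≡ map₂ suc (region k M a)
region-punchInℕ k M a with side-view k a
... | below a<k = trans (cong (region k (suc M)) (punchInℕ-< a<k))
                    (trans (region-< k (suc M) a<k) (cong (map₂ suc) (sym (region-< k M a<k))))
... | beyond a′ with side-view M a′
...   | below a′<M = trans (cong (region k (suc M)) (trans (punchInℕ-≥ (ℕ.m≤m+n k a′)) (sym (ℕ.+-suc k a′))))
                       (trans (region-inner k (suc M) (s≤s a′<M)) (cong (map₂ suc) (sym (region-inner k M a′<M))))
...   | beyond r   = trans (cong (region k (suc M)) (trans (punchInℕ-≥ (ℕ.m≤m+n k (M + r))) (sym (ℕ.+-suc k (M + r)))))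
                       (trans (region-outer k (suc M) r) (cong (map₂ suc) (sym (region-outer k M r))))

region-inj₂ : ∀ k M {i m} → region k M i ≡ inj₂ m → i ≡ k + m
region-inj₂ k M {i} eq with side-view k i
... | below i<k = contradiction (trans (sym (region-< k M i<k)) eq) λ ()
... | beyond i′ with side-view M i′
...   | below i′<M = cong (λ x → k + x) (inj₂-injective (trans (sym (region-inner k M i′<M)) eq))
...   | beyond r   = contradiction (trans (sym (region-outer k M r)) eq) λ ()

⊎ₘ-map₂-suc : ∀ P x y → (P ⊎ₘ δ) (map₂ suc x) (map₂ suc y) ≡ (P ⊎ₘ δ) x y
⊎ₘ-map₂-suc P (inj₁ a) (inj₁ b) = refl
⊎ₘ-map₂-suc P (inj₁ a) (inj₂ b) = refl
⊎ₘ-map₂-suc P (inj₂ a) (inj₁ b) = refl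
⊎ₘ-map₂-suc P (inj₂ a) (inj₂ b) = refl

insertIdentity : ℕ → ℕ → Matrix → Matrix
insertIdentity k M P i j = (P ⊎ₘ δ) (region k M i) (region k M j)

detN-insertIdentity : ∀ k M l P → detN (k + (M + l)) (insertIdentity k M P) ≡ detN (k + l) P
detN-insertIdentity k zero    l P = detN-cong (k + l) λ i j _ _ → cong₂ (P ⊎ₘ δ) (region-zero k i) (region-zero k j)
detN-insertIdentity k (suc M) l P = begin
  detN (k + (suc M + l)) S
    ≡⟨ cong (λ n → detN n S) (ℕ.+-suc k (M + l)) ⟩
  detN (suc (k + (M + l))) S
    ≡⟨ detN-expand-single-row (k + (M + l)) k k S (ℕ.m≤m+n k _) (ℕ.m≤m+n k _) row-k ⟩
  sgn (k + k) ℤ.* (S k k ℤ.* detN (k + (M + l)) (minor k k S))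
    ≡⟨ cong₂ (λ s x → s ℤ.* (x ℤ.* detN (k + (M + l)) (minor k k S)))
             (sgn-double k) (cong (λ x → (P ⊎ₘ δ) x x) region-k) ⟩
  + 1 ℤ.* (+ 1 ℤ.* detN (k + (M + l)) (minor k k S))
    ≡⟨ trans (ℤ.*-identityˡ _) (ℤ.*-identityˡ _) ⟩
  detN (k + (M + l)) (minor k k S)
    ≡⟨ detN-cong (k + (M + l)) (λ a b _ _ → trans (cong₂ (P ⊎ₘ δ) (region-punchInℕ k M a) (region-punchInℕ k M b))
                                                   (⊎ₘ-map₂-suc P (region k M a) (region k M b))) ⟩
  detN (k + (M + l)) (insertIdentity k M P)
    ≡⟨ detN-insertIdentity k M l P ⟩
  detN (k + l) P ∎
  where
  open ≡-Reasoning
  S : Matrix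
  S = insertIdentity k (suc M) P
  region-k : region k (suc M) k ≡ inj₂ 0
  region-k = trans (cong (region k (suc M)) (sym (ℕ.+-identityʳ k))) (region-inner k (suc M) (s≤s z≤n))
  row-k : ∀ j → j ≢ k → S k j ≡ + 0
  row-k j j≢k rewrite region-k with region k (suc M) j in eq
  ... | inj₁ _       = refl
  ... | inj₂ zero    = contradiction (trans (region-inj₂ k (suc M) eq) (ℕ.+-identityʳ k)) j≢k
  ... | inj₂ (suc _) = refl

form-sandwich : ∀ k M l G Mid K {u v u′ v′} →
  (∀ c → c < k → u′ c ≡ u c) → (∀ r → r < l → u′ (k + r) ≡ u (k + (M + r))) →
  (∀ c → c < k → v′ c ≡ v c) → (∀ r → r < l → v′ (k + r) ≡ v (k + (M + r))) →
  form (k + (M + l)) (G ⊕[ k ] (Mid ⊕[ M ] K)) u v ≡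
  form (k + l) (G ⊕[ k ] K) u′ v′ ℤ.+ form M Mid (λ m → u (k + m)) (λ m → v (k + m))
form-sandwich k M l G Mid K {u} {v} {u′} {v′} u′-low u′-high v′-low v′-high = begin
  form (k + (M + l)) (G ⊕[ k ] (Mid ⊕[ M ] K)) u v
    ≡⟨ form-⊕ k (M + l) G (Mid ⊕[ M ] K) u v ⟩
  form k G u v ℤ.+ form (M + l) (Mid ⊕[ M ] K) (λ m → u (k + m)) (λ m → v (k + m))
    ≡⟨ cong (λ x → form k G u v ℤ.+ x) (form-⊕ M l Mid K (λ m → u (k + m)) (λ m → v (k + m))) ⟩
  form k G u v ℤ.+ (middle ℤ.+ form l K (λ r → u (k + (M + r))) (λ r → v (k + (M + r))))
    ≡⟨ rearrange (form k G u v) middle _ ⟩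
  (form k G u v ℤ.+ form l K (λ r → u (k + (M + r))) (λ r → v (k + (M + r)))) ℤ.+ middle
    ≡⟨ cong (ℤ._+ middle) (cong₂ ℤ._+_ (form-cong k G u′-low v′-low) (form-cong l K u′-high v′-high)) ⟨
  (form k G u′ v′ ℤ.+ form l K (λ r → u′ (k + r)) (λ r → v′ (k + r))) ℤ.+ middle
    ≡⟨ cong (ℤ._+ middle) (form-⊕ k l G K u′ v′) ⟨
  form (k + l) (G ⊕[ k ] K) u′ v′ ℤ.+ middle ∎
  where
  open ≡-Reasoning
  middle = form M Mid (λ m → u (k + m)) (λ m → v (k + m))
  rearrange : ∀ a b c → a ℤ.+ (b ℤ.+ c) ≡ (a ℤ.+ c) ℤ.+ b
  rearrange = solve-∀

sandwich-entry : ∀ k M G Mid K i j →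
  (G ⊕[ k ] (Mid ⊕[ M ] K)) i j ≡ ((G ⊕[ k ] K) ⊎ₘ Mid) (region k M i) (region k M j)
sandwich-entry k M G Mid K i j with side-view k i | side-view k j
... | below i<k | below j<k
  rewrite region-< k M i<k | region-< k M j<k = trans (⊕-<< G k (Mid ⊕[ M ] K) i<k j<k) (sym (⊕-<< G k K i<k j<k))
... | below i<k | beyond j with side-view M j
...   | below j<M rewrite region-< k M i<k | region-inner k M j<M = ⊕-<+ G k (Mid ⊕[ M ] K) j i<k
...   | beyond r  rewrite region-< k M i<k | region-outer k M r =
  trans (⊕-<+ G k (Mid ⊕[ M ] K) (M + r) i<k) (sym (⊕-<+ G k K r i<k))
sandwich-entry k M G Mid K _ j | beyond i | below j<k with side-view M i
...   | below i<M rewrite region-inner k M i<M | region-< k M j<k = ⊕-+< G k (Mid ⊕[ M ] K) i j<k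
...   | beyond r  rewrite region-outer k M r | region-< k M j<k =
  trans (⊕-+< G k (Mid ⊕[ M ] K) (M + r) j<k) (sym (⊕-+< G k K r j<k))
sandwich-entry k M G Mid K _ _ | beyond i | beyond j with side-view M i | side-view M j
...   | below i<M | below j<M rewrite region-inner k M i<M | region-inner k M j<M =
  trans (⊕-++ G k (Mid ⊕[ M ] K) i j) (⊕-<< Mid M K i<M j<M)
...   | below i<M | beyond r  rewrite region-inner k M i<M | region-outer k M r =
  trans (⊕-++ G k (Mid ⊕[ M ] K) i (M + r)) (⊕-<+ Mid M K r i<M)
...   | beyond r  | below j<M rewrite region-outer k M r | region-inner k M j<M =
  trans (⊕-++ G k (Mid ⊕[ M ] K) (M + r) j) (⊕-+< Mid M K r j<M)
...   | beyond r  | beyond r′ rewrite region-outer k M r | region-outer k M r′ =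
  trans (⊕-++ G k (Mid ⊕[ M ] K) (M + r) (M + r′)) (trans (⊕-++ Mid M K r r′) (sym (⊕-++ G k K r r′)))

congruent₄-sandwich : ∀ {k l G G′ K K′} M Mid → Congruent₄ (k + l) (G ⊕[ k ] K) (G′ ⊕[ k ] K′) →
  Congruent₄ (k + (M + l)) (G ⊕[ k ] (Mid ⊕[ M ] K)) (G′ ⊕[ k ] (Mid ⊕[ M ] K′))
congruent₄-sandwich {k} {l} {G} {G′} {K} {K′} M Mid C = record
  { P          = S
  ; unimodular = subst IsUnit (sym (detN-insertIdentity k M l (P C))) (unimodular C)
  ; transforms = λ {i} {j} i<n j<n → ≡₄-trans (≡₄-reflexive (split i j))
      (≡₄-trans (⊎ₘ-transforms C (congruent₄-refl M Mid) (region k M i) (region k M j)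
                                 (region-∈ k M i<n) (region-∈ k M j<n))
                (≡₄-reflexive (sym (sandwich-entry k M G′ Mid K′ i j))))
  }
  where
  S : Matrix
  S = insertIdentity k M (P C)

  split : ∀ i j → form (k + (M + l)) (G ⊕[ k ] (Mid ⊕[ M ] K)) (column S i) (column S j) ≡
    form (k + l) (G ⊕[ k ] K) (λ c → (P C ⊎ₘ δ) (inj₁ c) (region k M i)) (λ c → (P C ⊎ₘ δ) (inj₁ c) (region k M j)) ℤ.+
    form M Mid (λ m → (P C ⊎ₘ δ) (inj₂ m) (region k M i)) (λ m → (P C ⊎ₘ δ) (inj₂ m) (region k M j))
  split i j = trans
    (form-sandwich k M l G Mid K (low i) (high i) (low j) (high j))
    (cong (λ x → form (k + l) (G ⊕[ k ] K) (outer i) (outer j) ℤ.+ x) (form-cong M Mid (inner i) (inner j)))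
    where
    outer : ℕ → ℕ → ℤ
    outer i c = (P C ⊎ₘ δ) (inj₁ c) (region k M i)
    low : ∀ i c → c < k → (P C ⊎ₘ δ) (inj₁ c) (region k M i) ≡ S c i
    low i c c<k = cong (λ x → (P C ⊎ₘ δ) x (region k M i)) (sym (region-< k M c<k))
    high : ∀ i r → r < l → (P C ⊎ₘ δ) (inj₁ (k + r)) (region k M i) ≡ S (k + (M + r)) i
    high i r _ = cong (λ x → (P C ⊎ₘ δ) x (region k M i)) (sym (region-outer k M r))
    inner : ∀ i m → m < M → S (k + m) i ≡ (P C ⊎ₘ δ) (inj₂ m) (region k M i)
    inner i m m<M = cong (λ x → (P C ⊎ₘ δ) x (region k M i)) (region-inner k M m<M)

infix 4 _≅₄_
record _≅₄_ (L L′ : List Block) : Set where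
  constructor _,_
  field
    sizes     : blockSize L ≡ blockSize L′
    congruent : Congruent₄ (blockSize L) (blockDiag L) (blockDiag L′)

≅₄-refl : ∀ L → L ≅₄ L
≅₄-refl L = refl , congruent₄-refl (blockSize L) (blockDiag L)

≅₄-++ : ∀ {L₁ L₁′ L₂ L₂′} → L₁ ≅₄ L₁′ → L₂ ≅₄ L₂′ → L₁ ++ L₂ ≅₄ L₁′ ++ L₂′
≅₄-++ {L₁} {L₁′} {L₂} {L₂′} (e₁ , C₁) (e₂ , C₂) =
  trans (blockSize-++ L₁ L₂) (trans (cong₂ _+_ e₁ e₂) (sym (blockSize-++ L₁′ L₂′))) ,
  congruent₄-reindex (sym (blockSize-++ L₁ L₂)) (λ i j → sym (blockDiag-++ L₁ L₂ i j))
    (λ i j → trans (cong (λ s → (blockDiag L₁′ ⊕[ s ] blockDiag L₂′) i j) e₁) (sym (blockDiag-++ L₁′ L₂′ i j)))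
    (congruent₄-⊕ C₁ C₂)

≅₄-sandwich : ∀ {L₁ L₁′ L₃ L₃′} Mid → blockSize L₁ ≡ blockSize L₁′ → L₁ ++ L₃ ≅₄ L₁′ ++ L₃′ →
  L₁ ++ Mid ++ L₃ ≅₄ L₁′ ++ Mid ++ L₃′
≅₄-sandwich {L₁} {L₁′} {L₃} {L₃′} Mid e₁ (e , C) =
  trans (sandwich-size L₁ L₃) (trans (cong₂ (λ a b → a + (blockSize Mid + b)) e₁ e₃) (sym (sandwich-size L₁′ L₃′))) ,
  congruent₄-reindex (sym (sandwich-size L₁ L₃)) (λ i j → sym (sandwich-blockDiag L₁ L₃ i j))
    (λ i j → trans (cong (λ s → (blockDiag L₁′ ⊕[ s ] (blockDiag Mid ⊕[ blockSize Mid ] blockDiag L₃′)) i j) e₁)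
                   (sym (sandwich-blockDiag L₁′ L₃′ i j)))
    (congruent₄-sandwich {blockSize L₁} {blockSize L₃} {blockDiag L₁} {blockDiag L₁′} {blockDiag L₃} {blockDiag L₃′}
                         (blockSize Mid) (blockDiag Mid) split)
  where
  e₃ : blockSize L₃ ≡ blockSize L₃′
  e₃ = ℕ.+-cancelˡ-≡ (blockSize L₁) _ _
    (trans (sym (blockSize-++ L₁ L₃)) (trans e (trans (blockSize-++ L₁′ L₃′) (cong (_+ blockSize L₃′) (sym e₁)))))
  sandwich-size : ∀ L L′ → blockSize (L ++ Mid ++ L′) ≡ blockSize L + (blockSize Mid + blockSize L′)
  sandwich-size L L′ = trans (blockSize-++ L (Mid ++ L′)) (cong (λ s → blockSize L + s) (blockSize-++ Mid L′))
  sandwich-blockDiag : ∀ L L′ i j → blockDiag (L ++ Mid ++ L′) i j ≡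
    (blockDiag L ⊕[ blockSize L ] (blockDiag Mid ⊕[ blockSize Mid ] blockDiag L′)) i j
  sandwich-blockDiag L L′ i j =
    trans (blockDiag-++ L (Mid ++ L′) i j) (⊕-congʳ (blockDiag L) (blockSize L) (blockDiag-++ Mid L′) i j)
  split : Congruent₄ (blockSize L₁ + blockSize L₃)
    (blockDiag L₁ ⊕[ blockSize L₁ ] blockDiag L₃) (blockDiag L₁′ ⊕[ blockSize L₁ ] blockDiag L₃′)
  split = congruent₄-reindex (blockSize-++ L₁ L₃) (blockDiag-++ L₁ L₃)
    (λ i j → trans (blockDiag-++ L₁′ L₃′ i j) (cong (λ s → (blockDiag L₁′ ⊕[ s ] blockDiag L₃′) i j) (sym e₁))) C

fromRows : List (List ℤ) → Matrix
fromRows []         _       _       = + 0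
fromRows (xs ∷ xss) zero    j       = entry xs j
  where
  entry : List ℤ → ℕ → ℤ
  entry []       _       = + 0
  entry (x ∷ xs) zero    = x
  entry (x ∷ xs) (suc j) = entry xs j
fromRows (xs ∷ xss) (suc i) j       = fromRows xss i j

≅₄-by-computation : ∀ L L′ P → blockSize L ≡ blockSize L′ → IsUnit (detN (blockSize L) P) →
  True (Fin.all? λ (a : Fin (blockSize L)) → Fin.all? λ b →
    form (blockSize L) (blockDiag L) (column P (toℕ a)) (column P (toℕ b)) ≡₄? blockDiag L′ (toℕ a) (toℕ b)) →
  L ≅₄ L′
≅₄-by-computation L L′ P size det checked = size , record
  { P          = P
  ; unimodular = det
  ; transforms = λ i<n j<n → subst₂ Transforms (Fin.toℕ-fromℕ< i<n) (Fin.toℕ-fromℕ< j<n)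
      (toWitness checked (Fin.fromℕ< i<n) (Fin.fromℕ< j<n))
  }
  where
  Transforms : ℕ → ℕ → Set
  Transforms i j = form (blockSize L) (blockDiag L) (column P i) (column P j) ≡₄ blockDiag L′ i j

2ℤ : ℤ
2ℤ = + 2

A₂ U 2U ⟨2⟩ ⟨0⟩ : Block
A₂  = mat2 (+ 2) (+ 1) (+ 1) (+ 2)
U   = mat2 (+ 0) (+ 1) (+ 1) (+ 0)
2U  = mat2 (+ 0) (+ 2) (+ 2) (+ 0)
⟨2⟩ = mat1 (+ 2)
⟨0⟩ = mat1 (+ 0)

-- In each matrix below, column i is the image of the i-th basis vector.
A₂A₂≅₄UU : A₂ ∷ A₂ ∷ [] ≅₄ U ∷ U ∷ []
A₂A₂≅₄UU = ≅₄-by-computation (A₂ ∷ A₂ ∷ []) (U ∷ U ∷ []) (fromRows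
  ( (-1ℤ ∷ -1ℤ ∷ -1ℤ ∷  0ℤ ∷ [])
  ∷ ( 0ℤ ∷  0ℤ ∷  1ℤ ∷ -1ℤ ∷ [])
  ∷ (-1ℤ ∷  1ℤ ∷  0ℤ ∷  0ℤ ∷ [])
  ∷ ( 2ℤ ∷  1ℤ ∷  1ℤ ∷  1ℤ ∷ [])
  ∷ [])) refl (inj₁ refl) _

UU≅₄A₂A₂ : U ∷ U ∷ [] ≅₄ A₂ ∷ A₂ ∷ []
UU≅₄A₂A₂ = ≅₄-by-computation (U ∷ U ∷ []) (A₂ ∷ A₂ ∷ []) (fromRows
  ( (-1ℤ ∷ -1ℤ ∷  0ℤ ∷ -1ℤ ∷ [])
  ∷ (-1ℤ ∷  0ℤ ∷  0ℤ ∷  1ℤ ∷ [])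
  ∷ ( 0ℤ ∷ -1ℤ ∷  1ℤ ∷ -1ℤ ∷ [])
  ∷ ( 0ℤ ∷  1ℤ ∷  1ℤ ∷  2ℤ ∷ [])
  ∷ [])) refl (inj₁ refl) _

A₂⟨2⟩≅₄U⟨2⟩ : A₂ ∷ ⟨2⟩ ∷ [] ≅₄ U ∷ ⟨2⟩ ∷ []
A₂⟨2⟩≅₄U⟨2⟩ = ≅₄-by-computation (A₂ ∷ ⟨2⟩ ∷ []) (U ∷ ⟨2⟩ ∷ []) (fromRows
  ( (-1ℤ ∷ -1ℤ ∷  0ℤ ∷ [])
  ∷ (-1ℤ ∷  0ℤ ∷  2ℤ ∷ [])
  ∷ (-1ℤ ∷ -1ℤ ∷ -1ℤ ∷ [])
  ∷ [])) refl (inj₁ refl) _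

U⟨2⟩≅₄A₂⟨2⟩ : U ∷ ⟨2⟩ ∷ [] ≅₄ A₂ ∷ ⟨2⟩ ∷ []
U⟨2⟩≅₄A₂⟨2⟩ = ≅₄-by-computation (U ∷ ⟨2⟩ ∷ []) (A₂ ∷ ⟨2⟩ ∷ []) (fromRows
  ( (-1ℤ ∷ -1ℤ ∷  2ℤ ∷ [])
  ∷ (-1ℤ ∷  0ℤ ∷  2ℤ ∷ [])
  ∷ ( 0ℤ ∷ -1ℤ ∷ -1ℤ ∷ [])
  ∷ [])) refl (inj₁ refl) _

A₂-Mid-⟨2⟩≅₄U-Mid-⟨2⟩ : ∀ Mid → A₂ ∷ Mid ++ ⟨2⟩ ∷ [] ≅₄ U ∷ Mid ++ ⟨2⟩ ∷ []
A₂-Mid-⟨2⟩≅₄U-Mid-⟨2⟩ Mid = ≅₄-sandwich {A₂ ∷ []} {U ∷ []} Mid refl A₂⟨2⟩≅₄U⟨2⟩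

U-Mid-⟨2⟩≅₄A₂-Mid-⟨2⟩ : ∀ Mid → U ∷ Mid ++ ⟨2⟩ ∷ [] ≅₄ A₂ ∷ Mid ++ ⟨2⟩ ∷ []
U-Mid-⟨2⟩≅₄A₂-Mid-⟨2⟩ Mid = ≅₄-sandwich {U ∷ []} {A₂ ∷ []} Mid refl U⟨2⟩≅₄A₂⟨2⟩

replicate-≅₄ : ∀ {X Y} → X ∷ X ∷ [] ≅₄ Y ∷ Y ∷ [] → (∀ Mid → X ∷ Mid ++ ⟨2⟩ ∷ [] ≅₄ Y ∷ Mid ++ ⟨2⟩ ∷ []) →
  ∀ d Mid L → replicate d X ++ Mid ++ ⟨2⟩ ∷ L ≅₄ replicate d Y ++ Mid ++ ⟨2⟩ ∷ L
replicate-≅₄         pair single zero          Mid L = ≅₄-refl (Mid ++ ⟨2⟩ ∷ L)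
replicate-≅₄ {X} {Y} pair single (suc zero)    Mid L =
  subst₂ _≅₄_ (reassoc X) (reassoc Y) (≅₄-++ (single Mid) (≅₄-refl L))
  where
  reassoc : ∀ Z → (Z ∷ Mid ++ ⟨2⟩ ∷ []) ++ L ≡ Z ∷ Mid ++ ⟨2⟩ ∷ L
  reassoc Z = cong (Z ∷_) (List.++-assoc Mid (⟨2⟩ ∷ []) L)
replicate-≅₄         pair single (suc (suc d)) Mid L = ≅₄-++ pair (replicate-≅₄ pair single d Mid L)

replicate-+ : ∀ {A : Set} m n (x : A) → replicate (m + n) x ≡ replicate m x ++ replicate n x
replicate-+ zero    n x = refl
replicate-+ (suc m) n x = cong (x ∷_) (replicate-+ m n x)

module _ (r d s t p m : ℕ) where
  private
    Mid Tail : List Block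
    Mid  = replicate s U ++ replicate t 2U
    Tail = replicate p ⟨2⟩ ++ replicate m ⟨0⟩

  nfBlocks-A₂ : nfBlocks (r + d) s t (suc p) m ≡ replicate r A₂ ++ replicate d A₂ ++ Mid ++ ⟨2⟩ ∷ Tail
  nfBlocks-A₂ = begin
    replicate (r + d) A₂ ++ replicate s U ++ replicate t 2U ++ ⟨2⟩ ∷ Tail
      ≡⟨ cong (_++ replicate s U ++ replicate t 2U ++ ⟨2⟩ ∷ Tail) (replicate-+ r d A₂) ⟩
    (replicate r A₂ ++ replicate d A₂) ++ replicate s U ++ replicate t 2U ++ ⟨2⟩ ∷ Tail
      ≡⟨ List.++-assoc (replicate r A₂) (replicate d A₂) _ ⟩
    replicate r A₂ ++ replicate d A₂ ++ replicate s U ++ replicate t 2U ++ ⟨2⟩ ∷ Tail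
      ≡⟨ cong (λ L → replicate r A₂ ++ replicate d A₂ ++ L) (List.++-assoc (replicate s U) (replicate t 2U) _) ⟨
    replicate r A₂ ++ replicate d A₂ ++ Mid ++ ⟨2⟩ ∷ Tail ∎
    where open ≡-Reasoning

  nfBlocks-U : nfBlocks r (d + s) t (suc p) m ≡ replicate r A₂ ++ replicate d U ++ Mid ++ ⟨2⟩ ∷ Tail
  nfBlocks-U = cong (replicate r A₂ ++_) (begin
    replicate (d + s) U ++ replicate t 2U ++ ⟨2⟩ ∷ Tail
      ≡⟨ cong (_++ replicate t 2U ++ ⟨2⟩ ∷ Tail) (replicate-+ d s U) ⟩
    (replicate d U ++ replicate s U) ++ replicate t 2U ++ ⟨2⟩ ∷ Tail
      ≡⟨ List.++-assoc (replicate d U) (replicate s U) _ ⟩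
    replicate d U ++ replicate s U ++ replicate t 2U ++ ⟨2⟩ ∷ Tail
      ≡⟨ cong (replicate d U ++_) (List.++-assoc (replicate s U) (replicate t 2U) _) ⟨
    replicate d U ++ Mid ++ ⟨2⟩ ∷ Tail ∎)
    where open ≡-Reasoning

  nfBlocks-A₂→U : nfBlocks (r + d) s t (suc p) m ≅₄ nfBlocks r (d + s) t (suc p) m
  nfBlocks-A₂→U = subst₂ _≅₄_ (sym nfBlocks-A₂) (sym nfBlocks-U)
    (≅₄-++ (≅₄-refl (replicate r A₂)) (replicate-≅₄ A₂A₂≅₄UU A₂-Mid-⟨2⟩≅₄U-Mid-⟨2⟩ d Mid Tail))

  nfBlocks-U→A₂ : nfBlocks r (d + s) t (suc p) m ≅₄ nfBlocks (r + d) s t (suc p) m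
  nfBlocks-U→A₂ = subst₂ _≅₄_ (sym nfBlocks-U) (sym nfBlocks-A₂)
    (≅₄-++ (≅₄-refl (replicate r A₂)) (replicate-≅₄ UU≅₄A₂A₂ U-Mid-⟨2⟩≅₄A₂-Mid-⟨2⟩ d Mid Tail))

Reduced : ℤ → Set
Reduced y = + (y %ℕ 4) ≡ y

blockDiag-reduced : ∀ L → All (λ b → ∀ i j → Reduced (proj₂ b i j)) L → ∀ i j → Reduced (blockDiag L i j)
blockDiag-reduced []            []         i j = refl
blockDiag-reduced ((k , f) ∷ L) (rf ∷ rL) i j =
  subst Reduced (sym (⊕-⊎ₘ f k (blockDiag L) i j)) (entry (side k i) (side k j))
  where
  entry : ∀ x y → Reduced ((f ⊎ₘ blockDiag L) x y)
  entry (inj₁ a) (inj₁ b) = rf a b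
  entry (inj₂ a) (inj₂ b) = blockDiag-reduced L rL a b
  entry (inj₁ a) (inj₂ b) = refl
  entry (inj₂ a) (inj₁ b) = refl

mat2-reduced : ∀ {a b c d} → Reduced a → Reduced b → Reduced c → Reduced d →
  ∀ i j → Reduced (proj₂ (mat2 a b c d) i j)
mat2-reduced ra rb rc rd 0 0 = ra
mat2-reduced ra rb rc rd 0 1 = rb
mat2-reduced ra rb rc rd 1 0 = rc
mat2-reduced ra rb rc rd 1 1 = rd
mat2-reduced ra rb rc rd 0 (suc (suc j)) = refl
mat2-reduced ra rb rc rd 1 (suc (suc j)) = refl
mat2-reduced ra rb rc rd (suc (suc i)) j = refl

mat1-reduced : ∀ {a} → Reduced a → ∀ i j → Reduced (proj₂ (mat1 a) i j)
mat1-reduced ra 0       0       = ra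
mat1-reduced ra 0       (suc j) = refl
mat1-reduced ra (suc i) j       = refl

nfBlocks-reduced : ∀ r s t p m i j → Reduced (blockDiag (nfBlocks r s t p m) i j)
nfBlocks-reduced r s t p m = blockDiag-reduced (nfBlocks r s t p m)
  (++⁺ (replicate⁺ r (mat2-reduced refl refl refl refl))
  (++⁺ (replicate⁺ s (mat2-reduced refl refl refl refl))
  (++⁺ (replicate⁺ t (mat2-reduced refl refl refl refl))
  (++⁺ (replicate⁺ p (mat1-reduced refl)) (replicate⁺ m (mat1-reduced refl))))))

hasNormalForm : ∀ {n} (A : Mat n n) {L} r s t p m → Mod4Eq A L → L ≅₄ nfBlocks r s t p m →
  HasNormalForm A r s t p m
hasNormalForm {n} A {L} r s t p m (n≡ , entries) (sizes , C) =
  Q , unimodular C′ , trans n≡ sizes ,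
  λ i j → trans (cong +_ (%ℕ4-cong (congruent i j))) (nfBlocks-reduced r s t p m _ _)
  where
  C′ : Congruent₄ n (blockDiag L) (blockDiag (nfBlocks r s t p m))
  C′ = congruent₄-reindex (sym n≡) (λ _ _ → refl) (λ _ _ → refl) C
  Q : Mat n n
  Q a b = P C′ (toℕ a) (toℕ b)
  reduce : ∀ l k → A l k ≡₄ blockDiag L (toℕ l) (toℕ k)
  reduce l k = ≡₄-trans (≡₄-%ℕ4 (A l k)) (≡₄-reflexive (entries l k))
  congruent : ∀ i j → (Q ᵀ ⊗ A ⊗ Q) i j ≡₄ blockDiag (nfBlocks r s t p m) (toℕ i) (toℕ j)
  congruent i j = ≡₄-trans
    (Σ-cong₄ n λ k → *-congʳ₄ (Q k j) (Σ-cong₄ n λ l → *-congˡ₄ (Q l i) (reduce l k)))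
    (transforms C′ (Fin.toℕ<n i) (Fin.toℕ<n j))

lemma2p5 : ∀ {n} (A : Mat n n) (r s t p m : ℕ) → p ≥ 1 →
    Symmetric A → Mod4Eq A (nfBlocks r s t p m) →
    (∀ r′ → r′ ≤ r + s → HasNormalForm A r′ (r + s ∸ r′) t p m)
    × ∃ λ s′ → ∃ λ t′ → ∃ λ p′ → ∃ λ m′ → HasNormalForm A 0 s′ t′ p′ m′
lemma2p5 A r s t (suc p) m _ _ hA = shift , (r + s ∸ 0 , t , suc p , m , shift 0 z≤n)
  where
  shift : ∀ r′ → r′ ≤ r + s → HasNormalForm A r′ (r + s ∸ r′) t (suc p) m
  shift r′ r′≤r+s with ℕ.≤-total r′ r
  ... | inj₁ r′≤r = subst (λ x → HasNormalForm A r′ x t (suc p) m) (sym (ℕ.+-∸-comm s r′≤r))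
    (hasNormalForm A r′ (r ∸ r′ + s) t (suc p) m
                   (subst (λ x → Mod4Eq A (nfBlocks x s t (suc p) m)) (sym (ℕ.m+[n∸m]≡n r′≤r)) hA)
                     (nfBlocks-A₂→U r′ (r ∸ r′) s t p m))
  ... | inj₂ r≤r′ = subst₂ (λ x y → HasNormalForm A x y t (suc p) m) r+d≡r′ w≡
    (hasNormalForm A (r + d) (s ∸ d) t (suc p) m
                   (subst (λ x → Mod4Eq A (nfBlocks r x t (suc p) m)) (sym (ℕ.m+[n∸m]≡n d≤s)) hA)
                     (nfBlocks-U→A₂ r d (s ∸ d) t p m))
    where
    d = r′ ∸ r
    r+d≡r′ : r + d ≡ r′
    r+d≡r′ = ℕ.m+[n∸m]≡n r≤r′
    d≤s : d ≤ s
    d≤s = ℕ.+-cancelˡ-≤ r d s (subst (_≤ r + s) (sym r+d≡r′) r′≤r+s)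
    w≡ : s ∸ d ≡ r + s ∸ r′
    w≡ = trans (sym (ℕ.[m+n]∸[m+o]≡n∸o r s d)) (cong (λ x → r + s ∸ x) r+d≡r′)
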